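{- For \textsc{Closed Geodetic Game}: (i) for every integer $k\ge 2$ and every vertex $u$ of the cycle $C_{2k}$, $\mathcal{G}(C_{2k},\{u\})=k$; (ii) for every integer $k\ge 1$ and every vertex $u$ of $C_{2k+1}$, $\mathcal{G}(C_{2k+1},\{u\})=0$; (iii) for every integer $k\ge 1$, denoting the vertices of $C_{2k+1}$ by $u_0,\ldots,u_{2k}$ in cyclic order, $\mathcal{G}(C_{2k+1},\{u_0,u_i\})=k+1-i$ for every $i\in\{1,\ldots,k\}$.
   Context: For vertices $x,y$, $\mathcal{I}(x,y)$ is the set of vertices on some shortest $x$–$y$ path ($\mathcal{I}(x,x)=\{x\}$); for a vertex set $S$, the geodetic closure is $(S)=\bigcup_{x,y\in S}\mathcal{I}(x,y)$. \textsc{Closed Geodetic Game} on a graph $H$ from position $H,S$ (the vertices of $S$ already selected): two players alternately add to $S$ a vertex not in the current closure $(S)$; when $(S)=V(H)$ there is no legal move and the game ends; the player making the last move wins. The options of a position are the positions reachable by one legal move; the Sprague–Grundy value is $\mathcal{G}(P)=\operatorname{mex}\{\mathcal{G}(P'):P'\text{ an option of }P\}$, where $\operatorname{mex}(X)$ is the least nonnegative integer not in $X$. -}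

module Defs where

open import Data.Nat using (ℕ; zero; suc; _+_; _≡ᵇ_)
open import Data.Fin using (Fin; toℕ)
open import Data.Fin.Subset using (Subset; ⁅_⁆; _∪_)
open import Data.Bool using (Bool; true; false; _∧_; _∨_; not; if_then_else_)
open import Data.List using (List; []; _∷_; length; concatMap)
open import Data.Bool.ListAction using (any)
open import Data.Vec using (tabulate; lookup)

open import Data.List.Base using () renaming (allFin to allFinL)

Graph : ℕ → Set
Graph n = Fin n → Fin n → Bool

vertices : (n : ℕ) → List (Fin n)
vertices n = allFinL n

step : ∀ {n} → Graph n → Subset n → Subset n
step {n} G B = tabulate λ z → lookup B z ∨ any (λ y → lookup B y ∧ G y z) (vertices n)

ball : ∀ {n} → Graph n → ℕ → Fin n → Subset n
ball G zero    x = ⁅ x ⁆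
ball G (suc k) x = step G (ball G k x)

distAux : ∀ {n} → Graph n → Fin n → Fin n → ℕ → ℕ → ℕ
distAux G x y k zero    = k
distAux G x y k (suc f) = if lookup (ball G k x) y then k else distAux G x y (suc k) f

-- shortest-path distance (correct for connected graphs, diameter < n)
dist : ∀ {n} → Graph n → Fin n → Fin n → ℕ
dist {n} G x y = distAux G x y 0 n

inInterval : ∀ {n} → Graph n → Fin n → Fin n → Fin n → Bool
inInterval G x y z = (dist G x z + dist G z y) ≡ᵇ dist G x y

closure : ∀ {n} → Graph n → Subset n → Subset n
closure {n} G S = tabulate λ z →
  any (λ x → lookup S x ∧ any (λ y → lookup S y ∧ inInterval G x y z) (vertices n)) (vertices n)

_∈ᵇ_ : ℕ → List ℕ → Bool
k ∈ᵇ []       = false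
k ∈ᵇ (m ∷ ms) = (k ≡ᵇ m) ∨ (k ∈ᵇ ms)

mexAux : List ℕ → ℕ → ℕ → ℕ
mexAux l k zero    = k
mexAux l k (suc f) = if k ∈ᵇ l then mexAux l (suc k) f else k

mex : List ℕ → ℕ
mex l = mexAux l 0 (suc (length l))

grundyF : ∀ {n} → Graph n → ℕ → Subset n → ℕ
grundyF G zero    S = 0
grundyF {n} G (suc f) S =
  mex (concatMap (λ v → if lookup (closure G S) v then [] else (grundyF G f (S ∪ ⁅ v ⁆) ∷ []))
                 (vertices n))

-- every move adds a new vertex to S, so at most n moves: fuel n is exact
grundy : ∀ {n} → Graph n → Subset n → ℕ
grundy {n} G S = grundyF G n S

cycle : (n : ℕ) → Graph n
cycle n i j =
  (suc (toℕ i) ≡ᵇ toℕ j) ∨ (suc (toℕ j) ≡ᵇ toℕ i)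
  ∨ ((toℕ i ≡ᵇ 0) ∧ (suc (toℕ j) ≡ᵇ n)) ∨ ((toℕ j ≡ᵇ 0) ∧ (suc (toℕ i) ≡ᵇ n))

-- Let m = ⌊(n − 1)/2⌋, so that on the cycle Cₙ an arc of length L ≤ m is the unique shortest
-- path between its ends. Call S an arc position if S lies on such an arc and contains both of
-- its ends; the geodetic closure of S is then exactly the arc. A singleton is an arc position
-- with L = 0, and {u₀, uᵢ} one with L = i. A legal move v either extends the arc, forwards or
-- backwards, to a longer arc of length L′ ≤ m (every L′ in (L, m] is reachable), or it cuts the
-- rest of the cycle into two arcs of length at most n/2 whose intervals cover everything; the
-- latter is possible exactly when n + L ≥ 2m + 2. By induction on m − L the Grundy value of an
-- arc position is m + 1 − L when such a closing move exists (the options are 0, 1, …, m − L),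
-- and 0 otherwise, which happens only for n odd and L = 0 (all options are longer arcs, of
-- positive value). For C₂ₖ one has m = k − 1, and for C₂ₖ₊₁ one has m = k.

module Submission where

open import Defs
open import Data.Nat using (ℕ; zero; suc; _+_; _*_; _∸_; _⊓_; _≤_; _<_; _≡ᵇ_; z≤n; s≤s; z<s; NonZero)
open import Data.Nat.DivMod using (_%_; m%n<n; n%n≡0; m%n≤m; m%n%n≡m%n; m<n⇒m%n≡m; [m+n]%n≡m%n; %-distribˡ-+)
open import Data.Nat.Properties
open import Data.Fin using (Fin; toℕ; fromℕ<)
open import Data.Fin.Properties using (toℕ<n; toℕ-injective; toℕ-fromℕ<; pigeonhole)
open import Data.Fin.Subset using (Subset; _∈_; _∉_; ⁅_⁆; _∪_)
open import Data.Fin.Subset.Properties using (x∈⁅x⁆; x∈⁅y⁆⇒x≡y; x∈p∪q⁻; x∈p∪q⁺)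
open import Data.Bool using (Bool; true; false; T; if_then_else_; _∧_)
open import Data.Bool.Properties using (T-∨; T-∧; T-≡)
open import Data.Bool.ListAction using (any)
open import Data.List using (List; []; _∷_; length; concatMap)
import Data.List as List
open import Data.List.Membership.Propositional using (find; lose) renaming (_∈_ to _∈ˡ_; _∉_ to _∉ˡ_)
open import Data.List.Membership.Propositional.Properties using (∈-allFin)
open import Data.List.Relation.Unary.Any as Any using (here; there)
open import Data.List.Relation.Unary.Any.Properties using (any⇔; concatMap⁻; concatMap⁺; lookup-index)
open import Data.Vec using (tabulate; lookup)
open import Data.Vec.Properties using (lookup∘tabulate; []=⇒lookup; lookup⇒[]=)
open import Data.Product using (_×_; _,_; ∃; ∃₂)
open import Data.Sum as Sum using (_⊎_; inj₁; inj₂)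
open import Function using (_∘_; flip; _⇔_; mk⇔; Equivalence)
open import Relation.Nullary using (¬_; contradiction; yes; no)
open import Relation.Binary.PropositionalEquality

open Equivalence using (to; from)

∈⇔T-lookup : ∀ {n} {p : Subset n} {x} → x ∈ p ⇔ T (lookup p x)
∈⇔T-lookup {p = p} {x} = mk⇔ (from T-≡ ∘ []=⇒lookup) (lookup⇒[]= x p ∘ to T-≡)

∈-tabulate⇔ : ∀ {n} {f : Fin n → Bool} {x} → x ∈ tabulate f ⇔ T (f x)
∈-tabulate⇔ {f = f} {x} rewrite sym (lookup∘tabulate f x) = ∈⇔T-lookup

any-vertices⇔ : ∀ {n} {f : Fin n → Bool} → T (any f (vertices n)) ⇔ ∃ λ x → T (f x)
any-vertices⇔ {n} {f} = mk⇔ (λ h → let x , _ , fx = find (from (any⇔ {xs = vertices n} {f}) h) in x , fx)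
                    (λ (x , fx) → to (any⇔ {xs = vertices n} {f}) (lose (∈-allFin x) fx))

∪⁅⁆-elim : ∀ {n} {P : Fin n → Set} {S v} → (∀ {x} → x ∈ S → P x) → P v → ∀ {x} → x ∈ S ∪ ⁅ v ⁆ → P x
∪⁅⁆-elim {S = S} {v} onS onv {x} x∈ with x∈p∪q⁻ S ⁅ v ⁆ x∈
... | inj₁ x∈S = onS x∈S
... | inj₂ x∈⁅v⁆ = subst _ (sym (x∈⁅y⁆⇒x≡y v x∈⁅v⁆)) onv

T-≡ᵇ : ∀ {a b} → T (a ≡ᵇ b) ⇔ a ≡ b
T-≡ᵇ {a} {b} = mk⇔ (≡ᵇ⇒≡ a b) (≡⇒≡ᵇ a b)

∈ᵇ⇔∈ : ∀ {k l} → T (k ∈ᵇ l) ⇔ k ∈ˡ l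
∈ᵇ⇔∈ {k} {[]} = mk⇔ (λ ()) (λ ())
∈ᵇ⇔∈ {k} {m ∷ l} = mk⇔ to′ from′
  where
  to′ : T (k ∈ᵇ (m ∷ l)) → k ∈ˡ m ∷ l
  to′ h with to T-∨ h
  ... | inj₁ k≡m = here (to T-≡ᵇ k≡m)
  ... | inj₂ k∈l = there (to ∈ᵇ⇔∈ k∈l)
  from′ : k ∈ˡ m ∷ l → T (k ∈ᵇ (m ∷ l))
  from′ (here k≡m) = from T-∨ (inj₁ (from T-≡ᵇ k≡m))
  from′ (there k∈l) = from T-∨ (inj₂ (from ∈ᵇ⇔∈ k∈l))

covering⇒≤length : ∀ {r l} → (∀ {j} → j < r → j ∈ˡ l) → r ≤ length l
covering⇒≤length {r} {l} cover with r ≤? length l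
... | yes r≤ = r≤
... | no r≰ = let i , j , i<j , same = pigeonhole (≰⇒> r≰) position in
  contradiction (trans (position-correct i) (trans (cong (List.lookup l) same) (sym (position-correct j)))) (<⇒≢ i<j)
  where
  position : Fin r → Fin (length l)
  position j = Any.index (cover (toℕ<n j))
  position-correct : ∀ j → toℕ j ≡ List.lookup l (position j)
  position-correct j = lookup-index (cover (toℕ<n j))

module _ {l : List ℕ} {r : ℕ} (below : ∀ {j} → j < r → j ∈ˡ l) (r∉l : r ∉ˡ l) where

  mexAux-≡ : ∀ k f → k ≤ r → r ≤ k + f → mexAux l k f ≡ r
  mexAux-≡ k zero k≤r r≤k+0 = ≤-antisym k≤r (subst (r ≤_) (+-identityʳ k) r≤k+0)
  mexAux-≡ k (suc f) k≤r r≤k+1+f with k ∈ᵇ l in k∈ᵇl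
  ... | true = mexAux-≡ (suc k) f (≤∧≢⇒< k≤r k≢r) (subst (r ≤_) (+-suc k f) r≤k+1+f)
    where
    k≢r : k ≢ r
    k≢r refl = r∉l (to ∈ᵇ⇔∈ (from T-≡ k∈ᵇl))
  ... | false = ≤-antisym k≤r (≮⇒≥ λ k<r → subst T k∈ᵇl (from ∈ᵇ⇔∈ (below k<r)))

  -- mex l only tries the candidates 0, 1, …, length l; covering⇒≤length shows that r is one of them.
  mex-≡ : mex l ≡ r
  mex-≡ = mexAux-≡ 0 (suc (length l)) z≤n (m≤n⇒m≤1+n (covering⇒≤length below))

module _ {n} (G : Graph n) where

  ∈-step⁻ : ∀ {B z} → z ∈ step G B → z ∈ B ⊎ ∃ λ y → y ∈ B × T (G y z)
  ∈-step⁻ z∈ with to T-∨ (to ∈-tabulate⇔ z∈)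
  ... | inj₁ z∈B = inj₁ (from ∈⇔T-lookup z∈B)
  ... | inj₂ near with to any-vertices⇔ near
  ...   | y , By∧Gyz = let By , Gyz = to T-∧ By∧Gyz in inj₂ (y , from ∈⇔T-lookup By , Gyz)

  ∈-step⁺ : ∀ {B z} → z ∈ B ⊎ (∃ λ y → y ∈ B × T (G y z)) → z ∈ step G B
  ∈-step⁺ h = from ∈-tabulate⇔ (from T-∨ (Sum.map (to ∈⇔T-lookup) near h))
    where
    near : ∀ {B z} → (∃ λ y → y ∈ B × T (G y z)) → T (any (λ y → lookup B y ∧ G y z) (vertices n))
    near (y , y∈B , Gyz) = from any-vertices⇔ (y , from T-∧ (to ∈⇔T-lookup y∈B , Gyz))

  ∈-closure⁻ : ∀ {S z} → z ∈ closure G S → ∃₂ λ x y → x ∈ S × y ∈ S × T (inInterval G x y z)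
  ∈-closure⁻ z∈ with to any-vertices⇔ (to ∈-tabulate⇔ z∈)
  ... | x , Sx∧rest with to T-∧ Sx∧rest
  ...   | Sx , rest with to any-vertices⇔ rest
  ...     | y , Sy∧I = let Sy , I = to T-∧ Sy∧I in x , y , from ∈⇔T-lookup Sx , from ∈⇔T-lookup Sy , I

  ∈-closure⁺ : ∀ {S x y z} → x ∈ S → y ∈ S → T (inInterval G x y z) → z ∈ closure G S
  ∈-closure⁺ {S} {x} {y} {z} x∈S y∈S I = from ∈-tabulate⇔ (from any-vertices⇔ (x , from T-∧ (to ∈⇔T-lookup x∈S ,
    from (any-vertices⇔ {f = λ y → lookup S y ∧ inInterval G x y z}) (y , from T-∧ (to ∈⇔T-lookup y∈S , I)))))

  option : ℕ → Subset n → Fin n → List ℕ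
  option f S v = if lookup (closure G S) v then [] else grundyF G f (S ∪ ⁅ v ⁆) ∷ []

  options : ℕ → Subset n → List ℕ
  options f S = concatMap (option f S) (vertices n)

  ∈-options⁻ : ∀ {f S j} → j ∈ˡ options f S → ∃ λ v → v ∉ closure G S × grundyF G f (S ∪ ⁅ v ⁆) ≡ j
  ∈-options⁻ {f} {S} {j} j∈ = let v , _ , h = find (concatMap⁻ (option f S) {xs = vertices n} j∈) in v , legal v h
    where
    legal : ∀ v → j ∈ˡ option f S v → v ∉ closure G S × grundyF G f (S ∪ ⁅ v ⁆) ≡ j
    legal v h with lookup (closure G S) v in v∈?
    legal v (here refl) | false = (λ v∈ → subst T v∈? (to ∈⇔T-lookup v∈)) , refl

  ∈-options⁺ : ∀ {f S v} → v ∉ closure G S → grundyF G f (S ∪ ⁅ v ⁆) ∈ˡ options f S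
  ∈-options⁺ {f} {S} {v} v∉ = concatMap⁺ (option f S) (lose (∈-allFin v) legal)
    where
    legal : grundyF G f (S ∪ ⁅ v ⁆) ∈ˡ option f S v
    legal with lookup (closure G S) v in v∈?
    ... | true = contradiction (from ∈⇔T-lookup (from T-≡ v∈?)) v∉
    ... | false = here refl

  Closed : Subset n → Set
  Closed S = ∀ z → z ∈ closure G S

  grundyF-closed : ∀ {S} → Closed S → ∀ f → grundyF G f S ≡ 0
  grundyF-closed closed zero = refl
  grundyF-closed {S} closed (suc f) =
    mex-≡ {options f S} (λ ()) λ 0∈ → let v , v∉ , _ = ∈-options⁻ {f} {S} 0∈ in v∉ (closed v)

module DistanceFromBalls {n} (G : Graph n) (d : Fin n → Fin n → ℕ) (d<n : ∀ x y → d x y < n)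
         (∈-ball⇔ : ∀ {k x y} → y ∈ ball G k x ⇔ d x y ≤ k) where

  distAux-≡ : ∀ {x y} k f → k ≤ d x y → d x y ≤ k + f → distAux G x y k f ≡ d x y
  distAux-≡ {x} {y} k zero k≤d d≤k+0 = ≤-antisym k≤d (subst (d x y ≤_) (+-identityʳ k) d≤k+0)
  distAux-≡ {x} {y} k (suc f) k≤d d≤k+1+f with lookup (ball G k x) y in y∈?
  ... | true = ≤-antisym k≤d (to ∈-ball⇔ (from ∈⇔T-lookup (from T-≡ y∈?)))
  ... | false = distAux-≡ (suc k) f (≤∧≢⇒< k≤d k≢d) (subst (d x y ≤_) (+-suc k f) d≤k+1+f)
    where
    k≢d : k ≢ d x y
    k≢d refl = subst T y∈? (to ∈⇔T-lookup (from ∈-ball⇔ ≤-refl))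

  dist-≡ : ∀ x y → dist G x y ≡ d x y
  dist-≡ x y = distAux-≡ 0 n z≤n (<⇒≤ (d<n x y))

  inInterval⇔ : ∀ {x y z} → T (inInterval G x y z) ⇔ d x z + d z y ≡ d x y
  inInterval⇔ {x} {y} {z} = mk⇔
    (λ I → trans (sym dist-sum) (trans (to T-≡ᵇ I) (dist-≡ x y)))
    (λ e → from T-≡ᵇ (trans dist-sum (trans e (sym (dist-≡ x y)))))
    where
    dist-sum : dist G x z + dist G z y ≡ d x z + d z y
    dist-sum = cong₂ _+_ (dist-≡ x z) (dist-≡ z y)

[m%d+n]%d≡[m+n]%d : ∀ m n d .{{_ : NonZero d}} → (m % d + n) % d ≡ (m + n) % d
[m%d+n]%d≡[m+n]%d m n d = begin
  (m % d + n) % d          ≡⟨ %-distribˡ-+ (m % d) n d ⟩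
  (m % d % d + n % d) % d  ≡⟨ cong (λ t → (t + n % d) % d) (m%n%n≡m%n m d) ⟩
  (m % d + n % d) % d      ≡⟨ %-distribˡ-+ m n d ⟨
  (m + n) % d              ∎
  where open ≡-Reasoning

[m+n%d]%d≡[m+n]%d : ∀ m n d .{{_ : NonZero d}} → (m + n % d) % d ≡ (m + n) % d
[m+n%d]%d≡[m+n]%d m n d = begin
  (m + n % d) % d  ≡⟨ cong (_% d) (+-comm m (n % d)) ⟩
  (n % d + m) % d  ≡⟨ [m%d+n]%d≡[m+n]%d n m d ⟩
  (n + m) % d      ≡⟨ cong (_% d) (+-comm n m) ⟩
  (m + n) % d      ∎
  where open ≡-Reasoning

-- The two minima are the cycle distances from position s to the positions 0 and d.
detour-length : ∀ {n d s} → d + d < n → d < s → s < n → d < s ⊓ (n ∸ s) + (s ∸ d) ⊓ (n ∸ (s ∸ d))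
detour-length {n} {d} {s} 2d<n d<s s<n with ⊓-sel s (n ∸ s) | ⊓-sel (s ∸ d) (n ∸ (s ∸ d))
... | inj₁ ≡s | _ rewrite ≡s = <-≤-trans d<s (m≤m+n s _)
... | inj₂ ≡n∸s | inj₁ ≡s∸d rewrite ≡n∸s | ≡s∸d = +-cancelʳ-< d d _ (subst (d + d <_) (sym n≡) 2d<n)
  where
  n≡ : n ∸ s + (s ∸ d) + d ≡ n
  n≡ = trans (+-assoc (n ∸ s) (s ∸ d) d) (trans (cong (n ∸ s +_) (m∸n+n≡m (<⇒≤ d<s))) (m∸n+n≡m (<⇒≤ s<n)))
... | inj₂ ≡n∸s | inj₂ ≡n∸[s∸d] rewrite ≡n∸s | ≡n∸[s∸d] =
  <-≤-trans (m+n≤o⇒m≤o∸n (suc d) (subst (_≤ n) (cong suc (sym (m+[n∸m]≡n (<⇒≤ d<s)))) s<n)) (m≤n+m _ (n ∸ s))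

half-bound : ∀ {m n x y} → n ≤ 2 + (m + m) → m < x → y + x ≡ n → y + y ≤ n
half-bound {m} {n} {x} {y} n≤2+2m m<x y+x≡n = subst (y + y ≤_) y+x≡n (+-monoʳ-≤ y y≤x)
  where
  y≤x : y ≤ x
  y≤x = +-cancelʳ-≤ x y x (≤-trans (≤-reflexive y+x≡n) (≤-trans n≤2+2m
          (≤-trans (≤-reflexive (cong suc (sym (+-suc m m)))) (+-mono-≤ m<x m<x))))

module Cycle (n : ℕ) {{_ : NonZero n}} where

  open ≡-Reasoning

  infixl 6 _⊕_
  _⊕_ : Fin n → ℕ → Fin n
  x ⊕ j = fromℕ< (m%n<n (toℕ x + j) n)

  toℕ-⊕ : ∀ x j → toℕ (x ⊕ j) ≡ (toℕ x + j) % n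
  toℕ-⊕ x j = toℕ-fromℕ< _

  toℕ%n : ∀ (x : Fin n) → toℕ x % n ≡ toℕ x
  toℕ%n x = m<n⇒m%n≡m (toℕ<n x)

  ⊕-identityʳ : ∀ x → x ⊕ 0 ≡ x
  ⊕-identityʳ x = toℕ-injective (begin
    toℕ (x ⊕ 0)      ≡⟨ toℕ-⊕ x 0 ⟩
    (toℕ x + 0) % n  ≡⟨ cong (_% n) (+-identityʳ (toℕ x)) ⟩
    toℕ x % n        ≡⟨ toℕ%n x ⟩
    toℕ x            ∎)

  ⊕-assoc : ∀ x i j → x ⊕ i ⊕ j ≡ x ⊕ (i + j)
  ⊕-assoc x i j = toℕ-injective (begin
    toℕ (x ⊕ i ⊕ j)            ≡⟨ toℕ-⊕ (x ⊕ i) j ⟩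
    (toℕ (x ⊕ i) + j) % n      ≡⟨ cong (λ t → (t + j) % n) (toℕ-⊕ x i) ⟩
    ((toℕ x + i) % n + j) % n  ≡⟨ [m%d+n]%d≡[m+n]%d (toℕ x + i) j n ⟩
    (toℕ x + i + j) % n        ≡⟨ cong (_% n) (+-assoc (toℕ x) i j) ⟩
    (toℕ x + (i + j)) % n      ≡⟨ toℕ-⊕ x (i + j) ⟨
    toℕ (x ⊕ (i + j))          ∎)

  ⊕-split : ∀ x {i j} → i ≤ j → x ⊕ j ≡ x ⊕ i ⊕ (j ∸ i)
  ⊕-split x {i} {j} i≤j = trans (cong (x ⊕_) (sym (m+[n∸m]≡n i≤j))) (sym (⊕-assoc x i (j ∸ i)))

  ⊕-split′ : ∀ x {i j} → i ≤ j → x ⊕ j ≡ x ⊕ (j ∸ i) ⊕ i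
  ⊕-split′ x {i} {j} i≤j = trans (cong (x ⊕_) (sym (m∸n+n≡m i≤j))) (sym (⊕-assoc x (j ∸ i) i))

  ⊕-n : ∀ x → x ⊕ n ≡ x
  ⊕-n x = toℕ-injective (trans (toℕ-⊕ x n) (trans ([m+n]%n≡m%n (toℕ x) n) (toℕ%n x)))

  ⊕-around : ∀ x {j} → j ≤ n → x ⊕ j ⊕ (n ∸ j) ≡ x
  ⊕-around x {j} j≤n = trans (sym (⊕-split x j≤n)) (⊕-n x)

  ⊕-cancelʳ : ∀ {x y j} → j ≤ n → x ⊕ j ≡ y ⊕ j → x ≡ y
  ⊕-cancelʳ {x} {y} {j} j≤n e = begin
    x                ≡⟨ ⊕-around x j≤n ⟨
    x ⊕ j ⊕ (n ∸ j)  ≡⟨ cong (_⊕ (n ∸ j)) e ⟩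
    y ⊕ j ⊕ (n ∸ j)  ≡⟨ ⊕-around y j≤n ⟩
    y                ∎

  fwd : Fin n → Fin n → ℕ
  fwd x y = (n ∸ toℕ x + toℕ y) % n

  fwd<n : ∀ x y → fwd x y < n
  fwd<n x y = m%n<n _ n

  ⊕-fwd : ∀ x y → x ⊕ fwd x y ≡ y
  ⊕-fwd x y = toℕ-injective (begin
    toℕ (x ⊕ fwd x y)                      ≡⟨ toℕ-⊕ x (fwd x y) ⟩
    (toℕ x + (n ∸ toℕ x + toℕ y) % n) % n  ≡⟨ [m+n%d]%d≡[m+n]%d (toℕ x) _ n ⟩
    (toℕ x + (n ∸ toℕ x + toℕ y)) % n      ≡⟨ cong (_% n) (+-assoc (toℕ x) _ (toℕ y)) ⟨
    (toℕ x + (n ∸ toℕ x) + toℕ y) % n      ≡⟨ cong (λ t → (t + toℕ y) % n) (m+[n∸m]≡n (<⇒≤ (toℕ<n x))) ⟩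
    (n + toℕ y) % n                        ≡⟨ cong (_% n) (+-comm n (toℕ y)) ⟩
    (toℕ y + n) % n                        ≡⟨ [m+n]%n≡m%n (toℕ y) n ⟩
    toℕ y % n                              ≡⟨ toℕ%n y ⟩
    toℕ y                                  ∎)

  fwd-⊕ : ∀ x j → fwd x (x ⊕ j) ≡ j % n
  fwd-⊕ x j = begin
    (n ∸ toℕ x + toℕ (x ⊕ j)) % n      ≡⟨ cong (λ t → (n ∸ toℕ x + t) % n) (toℕ-⊕ x j) ⟩
    (n ∸ toℕ x + (toℕ x + j) % n) % n  ≡⟨ [m+n%d]%d≡[m+n]%d (n ∸ toℕ x) _ n ⟩
    (n ∸ toℕ x + (toℕ x + j)) % n      ≡⟨ cong (_% n) (+-assoc (n ∸ toℕ x) (toℕ x) j) ⟨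
    (n ∸ toℕ x + toℕ x + j) % n        ≡⟨ cong (λ t → (t + j) % n) (m∸n+n≡m (<⇒≤ (toℕ<n x))) ⟩
    (n + j) % n                        ≡⟨ cong (_% n) (+-comm n j) ⟩
    (j + n) % n                        ≡⟨ [m+n]%n≡m%n j n ⟩
    j % n                              ∎

  fwd-⊕-≤ : ∀ x j → fwd x (x ⊕ j) ≤ j
  fwd-⊕-≤ x j = subst (_≤ j) (sym (fwd-⊕ x j)) (m%n≤m j n)

  fwd-⊕-< : ∀ x {j} → j < n → fwd x (x ⊕ j) ≡ j
  fwd-⊕-< x j<n = trans (fwd-⊕ x _) (m<n⇒m%n≡m j<n)

  fwd-self : ∀ x → fwd x x ≡ 0
  fwd-self x = n≤0⇒n≡0 (subst (λ y → fwd x y ≤ 0) (⊕-identityʳ x) (fwd-⊕-≤ x 0))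

  fwd-triangle : ∀ x y z → fwd x z ≤ fwd x y + fwd y z
  fwd-triangle x y z = subst (λ w → fwd x w ≤ fwd x y + fwd y z) x⊕sum≡z (fwd-⊕-≤ x _)
    where
    x⊕sum≡z : x ⊕ (fwd x y + fwd y z) ≡ z
    x⊕sum≡z = trans (sym (⊕-assoc x (fwd x y) (fwd y z))) (trans (cong (_⊕ fwd y z) (⊕-fwd x y)) (⊕-fwd y z))

  δ : Fin n → Fin n → ℕ
  δ x y = fwd x y ⊓ fwd y x

  δ-sym : ∀ x y → δ x y ≡ δ y x
  δ-sym x y = ⊓-comm (fwd x y) (fwd y x)

  δ<n : ∀ x y → δ x y < n
  δ<n x y = ≤-<-trans (m⊓n≤m (fwd x y) (fwd y x)) (fwd<n x y)

  Apart : ℕ → Fin n → Fin n → Set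
  Apart j x y = y ≡ x ⊕ j ⊎ x ≡ y ⊕ j

  Apart⇒δ≤ : ∀ {j x y} → Apart j x y → δ x y ≤ j
  Apart⇒δ≤ {j} {x} (inj₁ refl) = ≤-trans (m⊓n≤m _ _) (fwd-⊕-≤ x j)
  Apart⇒δ≤ {j} {y = y} (inj₂ refl) = ≤-trans (m⊓n≤n _ _) (fwd-⊕-≤ y j)

  δ-attained : ∀ x y → Apart (δ x y) x y
  δ-attained x y with ⊓-sel (fwd x y) (fwd y x)
  ... | inj₁ δ≡fwd = inj₁ (trans (sym (⊕-fwd x y)) (cong (x ⊕_) (sym δ≡fwd)))
  ... | inj₂ δ≡fwd = inj₂ (trans (sym (⊕-fwd y x)) (cong (y ⊕_) (sym δ≡fwd)))

  δ-self : ∀ x → δ x x ≡ 0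
  δ-self x = cong (λ t → t ⊓ t) (fwd-self x)

  δ≡0⇒≡ : ∀ {x y} → δ x y ≡ 0 → x ≡ y
  δ≡0⇒≡ {x} {y} δ≡0 with δ-attained x y
  ... | inj₁ y≡ = sym (trans y≡ (trans (cong (x ⊕_) δ≡0) (⊕-identityʳ x)))
  ... | inj₂ x≡ = trans x≡ (trans (cong (y ⊕_) δ≡0) (⊕-identityʳ y))

  δ-⊕ : ∀ x {j} → j < n → δ x (x ⊕ j) ≡ j ⊓ (n ∸ j)
  δ-⊕ x {zero} _ = trans (cong (δ x) (⊕-identityʳ x)) (δ-self x)
  δ-⊕ x {suc j} 1+j<n = cong₂ _⊓_ (fwd-⊕-< x 1+j<n) (begin
    fwd (x ⊕ suc j) x                          ≡⟨ cong (fwd (x ⊕ suc j)) (⊕-around x (<⇒≤ 1+j<n)) ⟨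
    fwd (x ⊕ suc j) (x ⊕ suc j ⊕ (n ∸ suc j))  ≡⟨ fwd-⊕-< (x ⊕ suc j) (∸-monoʳ-< z<s (<⇒≤ 1+j<n)) ⟩
    n ∸ suc j                                  ∎)

  δ-⊕-short : ∀ x {j} → j + j ≤ n → δ x (x ⊕ j) ≡ j
  δ-⊕-short x {zero} _ = trans (cong (δ x) (⊕-identityʳ x)) (δ-self x)
  δ-⊕-short x {suc j} 2j≤n = trans (δ-⊕ x j<n) (m≤n⇒m⊓n≡m (m+n≤o⇒m≤o∸n (suc j) 2j≤n))
    where
    j<n : suc j < n
    j<n = <-≤-trans (m<m+n (suc j) z<s) 2j≤n

  δ-path : ∀ {i j x y z} → i ≤ n → j ≤ n → Apart i x y → Apart j y z → δ x z ≤ i + j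
  δ-path {i} {j} {x} _ _ (inj₁ refl) (inj₁ refl) = Apart⇒δ≤ (inj₁ (⊕-assoc x i j))
  δ-path {i} {j} {z = z} _ _ (inj₂ refl) (inj₂ refl) =
    subst (λ k → δ (z ⊕ j ⊕ i) z ≤ k) (+-comm j i) (Apart⇒δ≤ (inj₂ (⊕-assoc z j i)))
  δ-path {i} {j} {y = y} _ _ (inj₂ refl) (inj₁ refl) with ≤-total i j
  ... | inj₁ i≤j = ≤-trans (Apart⇒δ≤ (inj₁ (⊕-split y i≤j))) (≤-trans (m∸n≤m j i) (m≤n+m j i))
  ... | inj₂ j≤i = ≤-trans (Apart⇒δ≤ (inj₂ (⊕-split y j≤i))) (≤-trans (m∸n≤m i j) (m≤m+n i j))
  δ-path {i} {j} {x} {z = z} i≤n j≤n (inj₁ refl) (inj₂ x⊕i≡z⊕j) with ≤-total i j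
  ... | inj₁ i≤j = ≤-trans (Apart⇒δ≤ (inj₂ (⊕-cancelʳ i≤n (trans x⊕i≡z⊕j (⊕-split′ z i≤j)))))
                           (≤-trans (m∸n≤m j i) (m≤n+m j i))
  ... | inj₂ j≤i = ≤-trans (Apart⇒δ≤ (inj₁ (⊕-cancelʳ j≤n (trans (sym x⊕i≡z⊕j) (⊕-split′ x j≤i)))))
                           (≤-trans (m∸n≤m i j) (m≤m+n i j))

  δ-triangle : ∀ x y z → δ x z ≤ δ x y + δ y z
  δ-triangle x y z = δ-path (<⇒≤ (δ<n x y)) (<⇒≤ (δ<n y z)) (δ-attained x y) (δ-attained y z)

  Apart-pred : ∀ {k x z} → Apart (suc k) x z → ∃ λ y → Apart k x y × Apart 1 y z
  Apart-pred {k} {x} (inj₁ refl) = x ⊕ k , inj₁ refl , inj₁ (trans (cong (x ⊕_) (+-comm 1 k)) (sym (⊕-assoc x k 1)))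
  Apart-pred {k} {z = z} (inj₂ refl) = z ⊕ 1 , inj₂ (sym (⊕-assoc z 1 k)) , inj₂ refl

  toℕ-⊕1-< : ∀ {y} → suc (toℕ y) < n → toℕ (y ⊕ 1) ≡ suc (toℕ y)
  toℕ-⊕1-< {y} 1+y<n = trans (toℕ-⊕ y 1) (trans (cong (_% n) (+-comm (toℕ y) 1)) (m<n⇒m%n≡m 1+y<n))

  toℕ-⊕1-≡ : ∀ {y} → suc (toℕ y) ≡ n → toℕ (y ⊕ 1) ≡ 0
  toℕ-⊕1-≡ {y} 1+y≡n = trans (toℕ-⊕ y 1) (trans (cong (_% n) (trans (+-comm (toℕ y) 1) 1+y≡n)) (n%n≡0 n))

  ≡⊕1⇔ : ∀ {y z} → z ≡ y ⊕ 1 ⇔ (suc (toℕ y) ≡ toℕ z ⊎ (toℕ z ≡ 0 × suc (toℕ y) ≡ n))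
  ≡⊕1⇔ {y} {z} = mk⇔ to′ from′
    where
    to′ : z ≡ y ⊕ 1 → suc (toℕ y) ≡ toℕ z ⊎ (toℕ z ≡ 0 × suc (toℕ y) ≡ n)
    to′ refl with m≤n⇒m<n∨m≡n (toℕ<n y)
    ... | inj₁ 1+y<n = inj₁ (sym (toℕ-⊕1-< 1+y<n))
    ... | inj₂ 1+y≡n = inj₂ (toℕ-⊕1-≡ 1+y≡n , 1+y≡n)
    from′ : suc (toℕ y) ≡ toℕ z ⊎ (toℕ z ≡ 0 × suc (toℕ y) ≡ n) → z ≡ y ⊕ 1
    from′ (inj₁ 1+y≡z) = toℕ-injective (trans (sym 1+y≡z) (sym (toℕ-⊕1-< (subst (_< n) (sym 1+y≡z) (toℕ<n z)))))
    from′ (inj₂ (z≡0 , 1+y≡n)) = toℕ-injective (trans z≡0 (sym (toℕ-⊕1-≡ 1+y≡n)))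

  C : Graph n
  C = cycle n

  adjacent⇔ : ∀ {y z} → T (C y z) ⇔ Apart 1 y z
  adjacent⇔ {y} {z} = mk⇔ to′ from′
    where
    a b c : Bool
    a = suc (toℕ y) ≡ᵇ toℕ z
    b = suc (toℕ z) ≡ᵇ toℕ y
    c = (toℕ y ≡ᵇ 0) ∧ (suc (toℕ z) ≡ᵇ n)
    to′ : T (C y z) → Apart 1 y z
    to′ h with to T-∨ h
    ... | inj₁ Ta = inj₁ (from ≡⊕1⇔ (inj₁ (to T-≡ᵇ Ta)))
    ... | inj₂ h′ with to T-∨ h′
    ...   | inj₁ Tb = inj₂ (from ≡⊕1⇔ (inj₁ (to T-≡ᵇ Tb)))
    ...   | inj₂ h″ with to T-∨ h″
    ...     | inj₁ Tc = let y≡0 , 1+z≡n = to T-∧ Tc in inj₂ (from ≡⊕1⇔ (inj₂ (to T-≡ᵇ y≡0 , to T-≡ᵇ 1+z≡n)))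
    ...     | inj₂ Td = let z≡0 , 1+y≡n = to T-∧ Td in inj₁ (from ≡⊕1⇔ (inj₂ (to T-≡ᵇ z≡0 , to T-≡ᵇ 1+y≡n)))
    from′ : Apart 1 y z → T (C y z)
    from′ (inj₁ z≡) with to ≡⊕1⇔ z≡
    ... | inj₁ e = from (T-∨ {a}) (inj₁ (from T-≡ᵇ e))
    ... | inj₂ (z0 , e) =
      from (T-∨ {a}) (inj₂ (from (T-∨ {b}) (inj₂ (from (T-∨ {c}) (inj₂ (from T-∧ (from T-≡ᵇ z0 , from T-≡ᵇ e)))))))
    from′ (inj₂ y≡) with to ≡⊕1⇔ y≡
    ... | inj₁ e = from (T-∨ {a}) (inj₂ (from (T-∨ {b}) (inj₁ (from T-≡ᵇ e))))
    ... | inj₂ (y0 , e) =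
      from (T-∨ {a}) (inj₂ (from (T-∨ {b}) (inj₂ (from (T-∨ {c}) (inj₁ (from T-∧ (from T-≡ᵇ y0 , from T-≡ᵇ e)))))))

  ∈-ball⇔ : ∀ {k x y} → y ∈ ball C k x ⇔ δ x y ≤ k
  ∈-ball⇔ {zero} {x} = mk⇔
    (λ y∈ → ≤-reflexive (trans (cong (δ x) (x∈⁅y⁆⇒x≡y x y∈)) (δ-self x)))
    (λ δ≤0 → subst (_∈ ⁅ x ⁆) (δ≡0⇒≡ (n≤0⇒n≡0 δ≤0)) (x∈⁅x⁆ x))
  ∈-ball⇔ {suc k} {x} {z} = mk⇔ to′ from′
    where
    to′ : z ∈ ball C (suc k) x → δ x z ≤ suc k
    to′ z∈ with ∈-step⁻ C z∈
    ... | inj₁ z∈ball = m≤n⇒m≤1+n (to (∈-ball⇔ {k}) z∈ball)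
    ... | inj₂ (y , y∈ball , y~z) = ≤-trans (δ-triangle x y z)
      (≤-trans (+-mono-≤ (to (∈-ball⇔ {k} {x}) y∈ball) (Apart⇒δ≤ (to (adjacent⇔ {y}) y~z))) (≤-reflexive (+-comm k 1)))
    from′ : δ x z ≤ suc k → z ∈ ball C (suc k) x
    from′ δ≤1+k with δ x z ≤? k
    ... | yes δ≤k = ∈-step⁺ C (inj₁ (from ∈-ball⇔ δ≤k))
    ... | no δ≰k =
      let y , x~y , y~z = Apart-pred (subst (λ j → Apart j x z) (≤-antisym δ≤1+k (≰⇒> δ≰k)) (δ-attained x z))
      in ∈-step⁺ C (inj₂ (y , from ∈-ball⇔ (Apart⇒δ≤ x~y) , from adjacent⇔ y~z))

  open DistanceFromBalls C δ δ<n ∈-ball⇔ using (inInterval⇔)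

  inInterval-sym : ∀ {x y z} → T (inInterval C x y z) → T (inInterval C y x z)
  inInterval-sym {x} {y} {z} I = from inInterval⇔ (begin
    δ y z + δ z x  ≡⟨ cong₂ _+_ (δ-sym y z) (δ-sym z x) ⟩
    δ z y + δ x z  ≡⟨ +-comm (δ z y) (δ x z) ⟩
    δ x z + δ z y  ≡⟨ to inInterval⇔ I ⟩
    δ x y          ≡⟨ δ-sym x y ⟩
    δ y x          ∎)

  ∈-interval-arc : ∀ x {d j} → d + d ≤ n → j ≤ d → T (inInterval C x (x ⊕ d) (x ⊕ j))
  ∈-interval-arc x {d} {j} 2d≤n j≤d = from inInterval⇔ (begin
    δ x (x ⊕ j) + δ (x ⊕ j) (x ⊕ d)            ≡⟨ cong (λ y → δ x (x ⊕ j) + δ (x ⊕ j) y) (⊕-split x j≤d) ⟩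
    δ x (x ⊕ j) + δ (x ⊕ j) (x ⊕ j ⊕ (d ∸ j))  ≡⟨ cong₂ _+_ (δ-⊕-short x (twice j≤d)) (δ-⊕-short (x ⊕ j) (twice d∸j≤d)) ⟩
    j + (d ∸ j)                                ≡⟨ m+[n∸m]≡n j≤d ⟩
    d                                          ≡⟨ δ-⊕-short x 2d≤n ⟨
    δ x (x ⊕ d)                                ∎)
    where
    d∸j≤d : d ∸ j ≤ d
    d∸j≤d = m∸n≤m d j
    twice : ∀ {i} → i ≤ d → i + i ≤ n
    twice i≤d = ≤-trans (+-mono-≤ i≤d i≤d) 2d≤n

  ∉-interval-arc : ∀ x {d s} → d + d < n → d < s → s < n → ¬ T (inInterval C x (x ⊕ d) (x ⊕ s))
  ∉-interval-arc x {d} {s} 2d<n d<s s<n I = <⇒≢ (detour-length 2d<n d<s s<n) (sym (begin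
    s ⊓ (n ∸ s) + (s ∸ d) ⊓ (n ∸ (s ∸ d))      ≡⟨ cong₂ _+_ (δ-⊕ x s<n) (δ-⊕ (x ⊕ d) s∸d<n) ⟨
    δ x (x ⊕ s) + δ (x ⊕ d) (x ⊕ d ⊕ (s ∸ d))  ≡⟨ cong (λ y → δ x (x ⊕ s) + δ (x ⊕ d) y) (⊕-split x d≤s) ⟨
    δ x (x ⊕ s) + δ (x ⊕ d) (x ⊕ s)            ≡⟨ cong (δ x (x ⊕ s) +_) (δ-sym (x ⊕ d) (x ⊕ s)) ⟩
    δ x (x ⊕ s) + δ (x ⊕ s) (x ⊕ d)            ≡⟨ to inInterval⇔ I ⟩
    δ x (x ⊕ d)                                ≡⟨ δ-⊕-short x (<⇒≤ 2d<n) ⟩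
    d                                          ∎))
    where
    d≤s : d ≤ s
    d≤s = <⇒≤ d<s
    s∸d<n : s ∸ d < n
    s∸d<n = ≤-<-trans (m∸n≤m s d) s<n

  ∈-interval-arc⁻ : ∀ x {d z} → d + d < n → T (inInterval C x (x ⊕ d) z) → fwd x z ≤ d
  ∈-interval-arc⁻ x {d} {z} 2d<n I = ≮⇒≥ λ d<fwd →
    ∉-interval-arc x 2d<n d<fwd (fwd<n x z) (subst (T ∘ inInterval C x (x ⊕ d)) (sym (⊕-fwd x z)) I)

-- The two bounds on m say m = ⌊(n − 1)/2⌋.
module ArcGame (n : ℕ) {{_ : NonZero n}} (m : ℕ) (2m<n : m + m < n) (n≤2+2m : n ≤ 2 + (m + m)) where

  open Cycle n

  record Arc (S : Subset n) (a : Fin n) (L : ℕ) : Set where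
    field
      short  : L ≤ m
      start∈ : a ∈ S
      end∈   : a ⊕ L ∈ S
      within : ∀ {x} → x ∈ S → fwd a x ≤ L

  m<n : m < n
  m<n = ≤-<-trans (m≤m+n m m) 2m<n

  2L<n : ∀ {L} → L ≤ m → L + L < n
  2L<n L≤m = ≤-<-trans (+-mono-≤ L≤m L≤m) 2m<n

  -- Some legal move from an arc position of length L closes the whole cycle (see move-Arc).
  CanFill : ℕ → Set
  CanFill L = 2 + (m + m) ≤ n + L

  CanFill-pos : ∀ {L} → 0 < L → CanFill L
  CanFill-pos {L} 0<L = subst (_≤ n + L) (+-comm (suc (m + m)) 1) (+-mono-≤ 2m<n 0<L)

  Extension : Subset n → ℕ → Set
  Extension S L = ∃₂ λ b L′ → L < L′ × Arc S b L′

  ∈-closure-arc : ∀ {S x d j} → x ∈ S → x ⊕ d ∈ S → d + d ≤ n → j ≤ d → x ⊕ j ∈ closure C S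
  ∈-closure-arc {x = x} x∈S x⊕d∈S 2d≤n j≤d = ∈-closure⁺ C x∈S x⊕d∈S (∈-interval-arc x 2d≤n j≤d)

  module _ {S a L} (arc : Arc S a L) where
    open Arc arc

    closure-Arc⁺ : ∀ {z} → fwd a z ≤ L → z ∈ closure C S
    closure-Arc⁺ {z} fwd≤L = subst (_∈ closure C S) (⊕-fwd a z) (∈-closure-arc start∈ end∈ (<⇒≤ (2L<n short)) fwd≤L)

    interval-on-arc : ∀ {x y z} → fwd a x ≤ fwd a y → fwd a y ≤ L → T (inInterval C x y z) → fwd a z ≤ L
    interval-on-arc {x} {y} {z} p≤q q≤L I = begin
      fwd a z                        ≤⟨ fwd-triangle a x z ⟩
      fwd a x + fwd x z              ≤⟨ +-monoʳ-≤ (fwd a x) (∈-interval-arc⁻ x 2d<n (subst (T ∘ flip (inInterval C x) z) y≡ I)) ⟩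
      fwd a x + (fwd a y ∸ fwd a x)  ≡⟨ m+[n∸m]≡n p≤q ⟩
      fwd a y                        ≤⟨ q≤L ⟩
      L                              ∎
      where
      open ≤-Reasoning
      y≡ : y ≡ x ⊕ (fwd a y ∸ fwd a x)
      y≡ = trans (sym (⊕-fwd a y)) (trans (⊕-split a p≤q) (cong (_⊕ (fwd a y ∸ fwd a x)) (⊕-fwd a x)))
      2d<n : (fwd a y ∸ fwd a x) + (fwd a y ∸ fwd a x) < n
      2d<n = 2L<n (≤-trans (m∸n≤m (fwd a y) (fwd a x)) (≤-trans q≤L short))

    closure-Arc⁻ : ∀ {z} → z ∈ closure C S → fwd a z ≤ L
    closure-Arc⁻ z∈ with ∈-closure⁻ C z∈
    ... | x , y , x∈S , y∈S , I with ≤-total (fwd a x) (fwd a y)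
    ...   | inj₁ p≤q = interval-on-arc p≤q (within y∈S) I
    ...   | inj₂ q≤p = interval-on-arc q≤p (within x∈S) (inInterval-sym I)

    ∉-closure-Arc⁻ : ∀ {v} → v ∉ closure C S → L < fwd a v
    ∉-closure-Arc⁻ v∉ = ≰⇒> (v∉ ∘ closure-Arc⁺)

    ∉-closure-Arc⁺ : ∀ {v} → L < fwd a v → v ∉ closure C S
    ∉-closure-Arc⁺ L<t v∈ = <⇒≱ L<t (closure-Arc⁻ v∈)

    v∈S∪⁅v⁆ : ∀ {v} → v ∈ S ∪ ⁅ v ⁆
    v∈S∪⁅v⁆ {v} = x∈p∪q⁺ (inj₂ (x∈⁅x⁆ v))

    S⊆S∪⁅v⁆ : ∀ {v x} → x ∈ S → x ∈ S ∪ ⁅ v ⁆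
    S⊆S∪⁅v⁆ x∈S = x∈p∪q⁺ (inj₁ x∈S)

    Arc-extendʳ : ∀ {v} → L < fwd a v → fwd a v ≤ m → Arc (S ∪ ⁅ v ⁆) a (fwd a v)
    Arc-extendʳ {v} L<t t≤m = record
      { short  = t≤m
      ; start∈ = S⊆S∪⁅v⁆ start∈
      ; end∈   = subst (_∈ S ∪ ⁅ v ⁆) (sym (⊕-fwd a v)) v∈S∪⁅v⁆
      ; within = ∪⁅⁆-elim (λ x∈S → ≤-trans (within x∈S) (<⇒≤ L<t)) ≤-refl }

    ⊕-back-to-start : ∀ v → v ⊕ (n ∸ fwd a v) ≡ a
    ⊕-back-to-start v = trans (cong (_⊕ (n ∸ fwd a v)) (sym (⊕-fwd a v))) (⊕-around a (<⇒≤ (fwd<n a v)))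

    Arc-extendˡ : ∀ {v} → n ∸ fwd a v + L ≤ m → Arc (S ∪ ⁅ v ⁆) v (n ∸ fwd a v + L)
    Arc-extendˡ {v} L′≤m = record
      { short  = L′≤m
      ; start∈ = v∈S∪⁅v⁆
      ; end∈   = subst (_∈ S ∪ ⁅ v ⁆) end≡ (S⊆S∪⁅v⁆ end∈)
      ; within = ∪⁅⁆-elim within-S (≤-trans (≤-reflexive (fwd-self v)) z≤n) }
      where
      end≡ : a ⊕ L ≡ v ⊕ (n ∸ fwd a v + L)
      end≡ = trans (cong (_⊕ L) (sym (⊕-back-to-start v))) (⊕-assoc v (n ∸ fwd a v) L)
      fwd-v-a : fwd v a ≤ n ∸ fwd a v
      fwd-v-a = subst (λ w → fwd v w ≤ n ∸ fwd a v) (⊕-back-to-start v) (fwd-⊕-≤ v _)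
      within-S : ∀ {x} → x ∈ S → fwd v x ≤ n ∸ fwd a v + L
      within-S {x} x∈S = begin
        fwd v x            ≤⟨ fwd-triangle v a x ⟩
        fwd v a + fwd a x  ≤⟨ +-mono-≤ fwd-v-a (within x∈S) ⟩
        n ∸ fwd a v + L    ∎
        where open ≤-Reasoning

    -- v cuts the cycle into the arcs [a, a ⊕ L], [a ⊕ L, v] and [v, a]; the last two have length
    -- at most n/2, so each is covered by the interval of its ends.
    Arc-fill : ∀ {v} → m < fwd a v → m < n ∸ fwd a v + L → Closed C (S ∪ ⁅ v ⁆)
    Arc-fill {v} m<t m<L′ z = subst (_∈ closure C (S ∪ ⁅ v ⁆)) (⊕-fwd a z) (cover (fwd a z) (fwd<n a z))
      where
      t : ℕ
      t = fwd a v
      L≤t : L ≤ t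
      L≤t = ≤-trans short (<⇒≤ m<t)
      t≤n : t ≤ n
      t≤n = <⇒≤ (fwd<n a v)
      cover : ∀ s → s < n → a ⊕ s ∈ closure C (S ∪ ⁅ v ⁆)
      cover s s<n with s ≤? L | s ≤? t
      ... | yes s≤L | _ = ∈-closure-arc (S⊆S∪⁅v⁆ start∈) (S⊆S∪⁅v⁆ end∈) (<⇒≤ (2L<n short)) s≤L
      ... | no s≰L | yes s≤t = subst (_∈ closure C (S ∪ ⁅ v ⁆)) (sym (⊕-split a L≤s))
            (∈-closure-arc (S⊆S∪⁅v⁆ end∈) (subst (_∈ S ∪ ⁅ v ⁆) v≡ v∈S∪⁅v⁆)
              (half-bound {y = t ∸ L} n≤2+2m m<L′ lengths) (∸-monoˡ-≤ L s≤t))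
        where
        L≤s : L ≤ s
        L≤s = <⇒≤ (≰⇒> s≰L)
        v≡ : v ≡ a ⊕ L ⊕ (t ∸ L)
        v≡ = trans (sym (⊕-fwd a v)) (⊕-split a L≤t)
        lengths : (t ∸ L) + (n ∸ t + L) ≡ n
        lengths = trans (+-comm (t ∸ L) _) (trans (+-assoc (n ∸ t) L (t ∸ L))
                    (trans (cong (n ∸ t +_) (m+[n∸m]≡n L≤t)) (m∸n+n≡m t≤n)))
      ... | no _ | no s≰t = subst (_∈ closure C (S ∪ ⁅ v ⁆)) z≡
            (∈-closure-arc v∈S∪⁅v⁆ (subst (_∈ S ∪ ⁅ v ⁆) (sym (⊕-back-to-start v)) (S⊆S∪⁅v⁆ start∈))
              (half-bound n≤2+2m m<t (m∸n+n≡m t≤n)) (∸-monoˡ-≤ t (<⇒≤ s<n)))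
        where
        z≡ : v ⊕ (s ∸ t) ≡ a ⊕ s
        z≡ = trans (cong (_⊕ (s ∸ t)) (sym (⊕-fwd a v))) (sym (⊕-split a (<⇒≤ (≰⇒> s≰t))))

    extend-move : ∀ {L′} → L < L′ → L′ ≤ m → ∃ λ v → v ∉ closure C S × Arc (S ∪ ⁅ v ⁆) a L′
    extend-move {L′} L<L′ L′≤m = a ⊕ L′ , ∉-closure-Arc⁺ (subst (L <_) (sym t≡L′) L<L′) ,
      subst (Arc (S ∪ ⁅ a ⊕ L′ ⁆) a) t≡L′
        (Arc-extendʳ (subst (L <_) (sym t≡L′) L<L′) (subst (_≤ m) (sym t≡L′) L′≤m))
      where
      t≡L′ : fwd a (a ⊕ L′) ≡ L′
      t≡L′ = fwd-⊕-< a (≤-<-trans L′≤m m<n)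

    fill-move : CanFill L → ∃ λ v → v ∉ closure C S × Closed C (S ∪ ⁅ v ⁆)
    fill-move canFill = a ⊕ suc m , ∉-closure-Arc⁺ (subst (L <_) (sym t≡1+m) (s≤s short)) ,
      Arc-fill (subst (m <_) (sym t≡1+m) ≤-refl) (subst (λ t → m < n ∸ t + L) (sym t≡1+m) m<L′)
      where
      1+m<n : suc m < n
      1+m<n = +-cancelʳ-≤ m (suc (suc m)) n (≤-trans canFill (+-monoʳ-≤ n short))
      2+2m≤1+m+n : suc m + suc m ≤ suc m + (n ∸ suc m + L)
      2+2m≤1+m+n = begin
        suc m + suc m            ≡⟨ cong suc (+-suc m m) ⟩
        2 + (m + m)              ≤⟨ canFill ⟩
        n + L                    ≡⟨ cong (_+ L) (m+[n∸m]≡n (<⇒≤ 1+m<n)) ⟨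
        suc m + (n ∸ suc m) + L  ≡⟨ +-assoc (suc m) _ L ⟩
        suc m + (n ∸ suc m + L)  ∎
        where open ≤-Reasoning
      m<L′ : m < n ∸ suc m + L
      m<L′ = +-cancelˡ-≤ (suc m) _ _ 2+2m≤1+m+n
      t≡1+m : fwd a (a ⊕ suc m) ≡ suc m
      t≡1+m = fwd-⊕-< a 1+m<n

  move-Arc : ∀ {S a L v} → Arc S a L → v ∉ closure C S →
             Extension (S ∪ ⁅ v ⁆) L ⊎ (CanFill L × Closed C (S ∪ ⁅ v ⁆))
  move-Arc {S} {a} {L} {v} arc v∉ with fwd a v ≤? m | n ∸ fwd a v + L ≤? m
  ... | yes t≤m | _ = inj₁ (a , fwd a v , ∉-closure-Arc⁻ arc v∉ , Arc-extendʳ arc (∉-closure-Arc⁻ arc v∉) t≤m)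
  ... | no _ | yes L′≤m = inj₁ (v , n ∸ fwd a v + L , m<n+m L (m<n⇒0<n∸m (fwd<n a v)) , Arc-extendˡ arc L′≤m)
  ... | no t≰m | no L′≰m = inj₂ (canFill , Arc-fill arc (≰⇒> t≰m) (≰⇒> L′≰m))
    where
    canFill : CanFill L
    canFill = begin
      2 + (m + m)                  ≡⟨ cong suc (+-suc m m) ⟨
      suc m + suc m                ≤⟨ +-mono-≤ (≰⇒> t≰m) (≰⇒> L′≰m) ⟩
      fwd a v + (n ∸ fwd a v + L)  ≡⟨ +-assoc (fwd a v) _ L ⟨
      fwd a v + (n ∸ fwd a v) + L  ≡⟨ cong (_+ L) (m+[n∸m]≡n (<⇒≤ (fwd<n a v))) ⟩
      n + L                        ∎
      where open ≤-Reasoning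

  module Options (f : ℕ) (ih : ∀ {S a L} → CanFill L → Arc S a L → m < f + L → grundyF C f S ≡ suc m ∸ L)
                 {S a L} (arc : Arc S a L) (fuel : m < suc f + L) where
    open Arc arc

    grundyF-Extension : ∀ {v} → Extension (S ∪ ⁅ v ⁆) L →
                        ∃ λ L′ → L < L′ × L′ ≤ m × grundyF C f (S ∪ ⁅ v ⁆) ≡ suc m ∸ L′
    grundyF-Extension (_ , L′ , L<L′ , arc′) =
      L′ , L<L′ , Arc.short arc′ , ih (CanFill-pos (≤-<-trans z≤n L<L′)) arc′ fuel′
      where
      fuel′ : m < f + L′
      fuel′ = <-≤-trans fuel (≤-trans (≤-reflexive (sym (+-suc f L))) (+-monoʳ-≤ f L<L′))

    options-below : ∀ {j} → j ∈ˡ options C f S → j < suc m ∸ L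
    options-below j∈ with ∈-options⁻ C {f} {S} j∈
    ... | v , v∉ , refl with move-Arc arc v∉
    ...   | inj₁ ext = let L′ , L<L′ , L′≤m , value = grundyF-Extension ext in
                       subst (_< suc m ∸ L) (sym value) (∸-monoʳ-< L<L′ (m≤n⇒m≤1+n L′≤m))
    ...   | inj₂ (_ , closed) = subst (_< suc m ∸ L) (sym (grundyF-closed C closed f)) (m<n⇒0<n∸m (s≤s short))

    below-options : CanFill L → ∀ {j} → j < suc m ∸ L → j ∈ˡ options C f S
    below-options canFill {zero} _ = let v , v∉ , closed = fill-move arc canFill in
      subst (_∈ˡ options C f S) (grundyF-closed C closed f) (∈-options⁺ C {f} {S} v∉)
    below-options _ {suc i} 1+i<1+m∸L = let v , v∉ , arc′ = extend-move arc L<m∸i (m∸n≤m m i) in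
      subst (_∈ˡ options C f S) (value arc′) (∈-options⁺ C {f} {S} v∉)
      where
      1+i≤m∸L : suc i ≤ m ∸ L
      1+i≤m∸L = ≤-pred (subst (suc (suc i) ≤_) (+-∸-assoc 1 short) 1+i<1+m∸L)
      i≤m : i ≤ m
      i≤m = ≤-trans (n≤1+n i) (≤-trans 1+i≤m∸L (m∸n≤m m L))
      L<m∸i : L < m ∸ i
      L<m∸i = m+n≤o⇒m≤o∸n (suc L) (subst (_≤ m) (cong suc (+-comm i L)) (m≤o∸n⇒m+n≤o (suc i) short 1+i≤m∸L))
      value : ∀ {v} → Arc (S ∪ ⁅ v ⁆) a (m ∸ i) → grundyF C f (S ∪ ⁅ v ⁆) ≡ suc i
      value arc′ = let _ , _ , _ , value′ = grundyF-Extension (a , m ∸ i , L<m∸i , arc′) in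
        trans value′ (trans (+-∸-assoc 1 (m∸n≤m m i)) (cong suc (m∸[m∸n]≡n i≤m)))

    0∉options : ¬ CanFill L → 0 ∉ˡ options C f S
    0∉options stuck 0∈ with ∈-options⁻ C {f} {S} 0∈
    ... | v , v∉ , value with move-Arc arc v∉
    ...   | inj₁ ext = let L′ , _ , L′≤m , value′ = grundyF-Extension ext in
                       <⇒≢ (m<n⇒0<n∸m (s≤s L′≤m)) (sym (trans (sym value′) value))
    ...   | inj₂ (canFill , _) = stuck canFill

  -- Every move lengthens the arc and arc lengths stay ≤ m, so fuel f with m < f + L suffices.
  grundyF-Arc : ∀ f {S a L} → CanFill L → Arc S a L → m < f + L → grundyF C f S ≡ suc m ∸ L
  grundyF-Arc zero _ arc m<L = contradiction (Arc.short arc) (<⇒≱ m<L)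
  grundyF-Arc (suc f) {S} canFill arc fuel =
    mex-≡ {options C f S} (below-options canFill) (λ r∈ → <-irrefl refl (options-below r∈))
    where open Options f (grundyF-Arc f) arc fuel

  grundyF-Arc-stuck : ∀ f {S a L} → ¬ CanFill L → Arc S a L → m < f + L → grundyF C f S ≡ 0
  grundyF-Arc-stuck zero _ _ _ = refl
  grundyF-Arc-stuck (suc f) {S} stuck arc fuel = mex-≡ {options C f S} (λ ()) (0∉options stuck)
    where open Options f (grundyF-Arc f) arc fuel

  grundy-Arc : ∀ {S a L} → CanFill L → Arc S a L → grundy C S ≡ suc m ∸ L
  grundy-Arc {L = L} canFill arc = grundyF-Arc n canFill arc (<-≤-trans m<n (m≤m+n n L))

  grundy-Arc-stuck : ∀ {S a L} → ¬ CanFill L → Arc S a L → grundy C S ≡ 0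
  grundy-Arc-stuck {L = L} stuck arc = grundyF-Arc-stuck n stuck arc (<-≤-trans m<n (m≤m+n n L))

  Arc-singleton : ∀ u → Arc ⁅ u ⁆ u 0
  Arc-singleton u = record
    { short  = z≤n
    ; start∈ = x∈⁅x⁆ u
    ; end∈   = subst (_∈ ⁅ u ⁆) (sym (⊕-identityʳ u)) (x∈⁅x⁆ u)
    ; within = λ x∈ → ≤-reflexive (trans (cong (fwd u) (x∈⁅y⁆⇒x≡y u x∈)) (fwd-self u)) }

  Arc-pair : ∀ a {i} → i ≤ m → Arc (⁅ a ⁆ ∪ ⁅ a ⊕ i ⁆) a i
  Arc-pair a {i} i≤m = record
    { short  = i≤m
    ; start∈ = x∈p∪q⁺ (inj₁ (x∈⁅x⁆ a))
    ; end∈   = x∈p∪q⁺ (inj₂ (x∈⁅x⁆ (a ⊕ i)))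
    ; within = ∪⁅⁆-elim (λ x∈ → ≤-trans (≤-reflexive (trans (cong (fwd a) (x∈⁅y⁆⇒x≡y a x∈)) (fwd-self a))) z≤n)
                        (fwd-⊕-≤ a i) }

2*m≡m+m : ∀ m → 2 * m ≡ m + m
2*m≡m+m m = cong (m +_) (+-identityʳ m)

2*[1+m]≡2+[m+m] : ∀ m → 2 * suc m ≡ 2 + (m + m)
2*[1+m]≡2+[m+m] m = trans (2*m≡m+m (suc m)) (cong suc (+-suc m m))

module EvenCycle (m : ℕ) = ArcGame (2 * suc m) m
  (subst (m + m <_) (sym (2*[1+m]≡2+[m+m] m)) (<-trans (n<1+n _) (n<1+n _))) (≤-reflexive (2*[1+m]≡2+[m+m] m))

module OddCycle (k : ℕ) = ArcGame (suc (2 * k)) k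
  (s≤s (≤-reflexive (sym (2*m≡m+m k)))) (s≤s (m≤n⇒m≤1+n (≤-reflexive (2*m≡m+m k))))

grundy-even-cycle : ∀ m (u : Fin (2 * suc m)) → grundy (cycle (2 * suc m)) ⁅ u ⁆ ≡ suc m
grundy-even-cycle m u = grundy-Arc (≤-reflexive (sym (trans (+-identityʳ _) (2*[1+m]≡2+[m+m] m)))) (Arc-singleton u)
  where open EvenCycle m

grundy-odd-cycle : ∀ k (u : Fin (suc (2 * k))) → grundy (cycle (suc (2 * k))) ⁅ u ⁆ ≡ 0
grundy-odd-cycle k u = grundy-Arc-stuck cannot-fill (Arc-singleton u)
  where
  open OddCycle k
  cannot-fill : ¬ CanFill 0
  cannot-fill canFill = 1+n≰n (subst (2 + (k + k) ≤_) (trans (+-identityʳ _) (cong suc (2*m≡m+m k))) canFill)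

grundy-odd-cycle-pair : ∀ k {i} → 1 ≤ i → i ≤ k → (i<n : i < suc (2 * k)) →
                        grundy (cycle (suc (2 * k))) (⁅ Fin.zero ⁆ ∪ ⁅ fromℕ< i<n ⁆) ≡ suc k ∸ i
grundy-odd-cycle-pair k {i} 1≤i i≤k i<n =
  trans (cong (λ b → grundy C (⁅ Fin.zero ⁆ ∪ ⁅ b ⁆)) fromℕ<≡0⊕i)
        (grundy-Arc (CanFill-pos 1≤i) (Arc-pair Fin.zero i≤k))
  where
  open OddCycle k
  open Cycle (suc (2 * k))
  fromℕ<≡0⊕i : fromℕ< i<n ≡ Fin.zero ⊕ i
  fromℕ<≡0⊕i = toℕ-injective (trans (toℕ-fromℕ< i<n) (sym (trans (toℕ-⊕ Fin.zero i) (m<n⇒m%n≡m i<n))))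

proposition4 : ((k : ℕ) → 2 ≤ k → (u : Fin (2 * k)) → grundy (cycle (2 * k)) ⁅ u ⁆ ≡ k)
    × ((k : ℕ) → 1 ≤ k → (u : Fin (suc (2 * k))) → grundy (cycle (suc (2 * k))) ⁅ u ⁆ ≡ 0)
    × ((k : ℕ) → 1 ≤ k → (i : ℕ) → 1 ≤ i → i ≤ k → (i<n : i < suc (2 * k)) →
    grundy (cycle (suc (2 * k))) (⁅ Fin.zero ⁆ ∪ ⁅ fromℕ< i<n ⁆) ≡ k + 1 ∸ i)
proposition4 =
  (λ { zero () ; (suc m) _ → grundy-even-cycle m }) ,
  (λ k _ → grundy-odd-cycle k) ,
  (λ k _ i 1≤i i≤k i<n → trans (grundy-odd-cycle-pair k 1≤i i≤k i<n) (cong (_∸ i) (+-comm 1 k)))
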